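{- A dagger kernel category is Boolean if and only if, for each object $X$, the orthomodular lattice $\mathrm{KSub}(X)$ is a Boolean algebra.
   Context: A dagger category is a category with a contravariant functor $\dagger$ that is the identity on objects with $f^{\dagger\dagger}=f$; $f$ is a dagger mono if $f^\dagger\circ f=\mathrm{id}$. A dagger kernel category is a dagger category with a zero object $0$ in which every morphism $f$ has a kernel (universal $k$ with $f\circ k=0$) that can be chosen to be a dagger mono, denoted $\ker(f)$. $m^\perp=\ker(m^\dagger)$. $\mathrm{KSub}(X)$ is the poset of kernels with codomain $X$ modulo isomorphism of domains, with $m\le n$ iff $m=n\circ\varphi$ for some $\varphi$; it is an orthomodular lattice with meets given by pullback, joins $m\vee n=(m^\perp\wedge n^\perp)^\perp$, bottom $0$, top $1=\mathrm{id}_X$, and orthocomplement $(-)^\perp$. The dagger kernel category is Boolean if for all kernels $m,n$ with common codomain, $m\wedge n=0$ implies $m^\dagger\circ n=0$. -}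

module Defs where

open import Level using (Level; _⊔_; suc)
open import Data.Product using (Σ; Σ-syntax; _×_; _,_; proj₁; proj₂)
open import Relation.Binary.PropositionalEquality using (_≡_; refl; sym; trans; cong)
open import Algebra.Lattice.Structures using (IsBooleanAlgebra)

record Category (o ℓ : Level) : Set (suc (o ⊔ ℓ)) where
  infixr 9 _∘_
  field
    Obj   : Set o
    Hom   : Obj → Obj → Set ℓ
    id    : ∀ {A} → Hom A A
    _∘_   : ∀ {A B C} → Hom B C → Hom A B → Hom A C
    assoc : ∀ {A B C D} (h : Hom C D) (g : Hom B C) (f : Hom A B) →
            (h ∘ g) ∘ f ≡ h ∘ (g ∘ f)
    identityˡ : ∀ {A B} (f : Hom A B) → id ∘ f ≡ f
    identityʳ : ∀ {A B} (f : Hom A B) → f ∘ id ≡ f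

record DaggerCategory (o ℓ : Level) : Set (suc (o ⊔ ℓ)) where
  field
    category : Category o ℓ
  open Category category public
  field
    _† : ∀ {A B} → Hom A B → Hom B A
    †-id  : ∀ {A} → (id {A}) † ≡ id
    †-∘   : ∀ {A B C} (g : Hom B C) (f : Hom A B) → (g ∘ f) † ≡ (f †) ∘ (g †)
    †-inv : ∀ {A B} (f : Hom A B) → (f †) † ≡ f

  IsDaggerMono : ∀ {A B} → Hom A B → Set ℓ
  IsDaggerMono f = (f †) ∘ f ≡ id

record ZeroObject {o ℓ} (C : Category o ℓ) : Set (o ⊔ ℓ) where
  open Category C
  field
    𝟘        : Obj
    ¡        : ∀ {A} → Hom 𝟘 A
    ¡-unique : ∀ {A} (f : Hom 𝟘 A) → f ≡ ¡
    !        : ∀ {A} → Hom A 𝟘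
    !-unique : ∀ {A} (f : Hom A 𝟘) → f ≡ !

  zero : ∀ {A B} → Hom A B
  zero = ¡ ∘ !

module _ {o ℓ} (C : Category o ℓ) (Z : ZeroObject C) where
  open Category C
  open ZeroObject Z

  record IsKernel {K A B : Obj} (f : Hom A B) (k : Hom K A) : Set (o ⊔ ℓ) where
    field
      equation  : f ∘ k ≡ zero
      factor    : ∀ {W} (g : Hom W A) → f ∘ g ≡ zero → Hom W K
      factor-eq : ∀ {W} (g : Hom W A) (p : f ∘ g ≡ zero) → k ∘ factor g p ≡ g
      factor-unique : ∀ {W} (g : Hom W A) (p : f ∘ g ≡ zero) (ψ : Hom W K) →
                      k ∘ ψ ≡ g → ψ ≡ factor g p

record DaggerKernelCategory (o ℓ : Level) : Set (suc (o ⊔ ℓ)) where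
  field
    daggerCategory : DaggerCategory o ℓ
  open DaggerCategory daggerCategory public
  field
    zeroObject : ZeroObject category
  open ZeroObject zeroObject public
  field
    KerObj        : ∀ {A B} → Hom A B → Obj
    ker           : ∀ {A B} (f : Hom A B) → Hom (KerObj f) A
    ker-isKernel  : ∀ {A B} (f : Hom A B) → IsKernel category zeroObject f (ker f)
    ker-daggerMono : ∀ {A B} (f : Hom A B) → IsDaggerMono (ker f)

module KSubDefs {o ℓ} (C : DaggerKernelCategory o ℓ) where
  open DaggerKernelCategory C

  IsAKernel : ∀ {Y X} → Hom Y X → Set (o ⊔ ℓ)
  IsAKernel {Y} {X} m = Σ[ B ∈ Obj ] Σ[ f ∈ Hom X B ] IsKernel category zeroObject f m

  -- elements of KSub(X) (before quotienting): kernels with codomain X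
  record KSubElt (X : Obj) : Set (o ⊔ ℓ) where
    constructor ksub
    field
      dom      : Obj
      arr      : Hom dom X
      isKernel : IsAKernel arr
  open KSubElt public

  _≤K_ : ∀ {X} → KSubElt X → KSubElt X → Set ℓ
  m ≤K n = Σ[ φ ∈ Hom (dom m) (dom n) ] arr m ≡ arr n ∘ φ

  -- equality in KSub(X): the quotient by isomorphism of domains,
  -- presented as a setoid (mutual ≤)
  _≈K_ : ∀ {X} → KSubElt X → KSubElt X → Set ℓ
  m ≈K n = (m ≤K n) × (n ≤K m)

  bottomIsKernel : ∀ {X} → IsAKernel (¡ {X})
  bottomIsKernel {X} = X , id , record
    { equation = trans (identityˡ (¡ {X})) (sym (¡-unique (¡ ∘ !)))
    ; factor = λ g p → !
    ; factor-eq = λ g p → sym (trans (sym (identityˡ g)) p)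
    ; factor-unique = λ g p ψ q → !-unique ψ
    }

  ⊥K : ∀ {X} → KSubElt X
  ⊥K {X} = ksub 𝟘 ¡ bottomIsKernel

  MeetIsZero : ∀ {X} → KSubElt X → KSubElt X → Set (o ⊔ ℓ)
  MeetIsZero {X} m n = ∀ (k : KSubElt X) → k ≤K m → k ≤K n → k ≤K ⊥K

  -- KSub(X) is a Boolean algebra: the poset (KSub(X), ≤) carries a Boolean
  -- algebra structure (w.r.t. its equality ≈K) whose induced order is ≤.
  KSubIsBooleanAlgebra : Obj → Set (o ⊔ ℓ)
  KSubIsBooleanAlgebra X =
    Σ[ join ∈ (KSubElt X → KSubElt X → KSubElt X) ]
    Σ[ meet ∈ (KSubElt X → KSubElt X → KSubElt X) ]
    Σ[ compl ∈ (KSubElt X → KSubElt X) ]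
    Σ[ top ∈ KSubElt X ]
    Σ[ bot ∈ KSubElt X ]
      (IsBooleanAlgebra (_≈K_ {X}) join meet compl top bot
       × (∀ m n → ((m ≤K n → meet m n ≈K m) × (meet m n ≈K m → m ≤K n))))

IsBooleanDKC : ∀ {o ℓ} → DaggerKernelCategory o ℓ → Set (o ⊔ ℓ)
IsBooleanDKC C =
  ∀ {X} (m n : KSubElt X) → MeetIsZero m n → (arr m †) ∘ arr n ≡ zero
  where open DaggerKernelCategory C
        open KSubDefs C

module Submission where

-- KSub(X) is ordered by factorisation, and its orthocomplement is m⊥ = ker(m†).
-- In any dagger kernel category the kernels are closed (m = m⊥⊥), so KSub(X) is a
-- bounded lattice: the meet a ∧ b is the closure of the pullback a ∘ ker((b⊥)† ∘ a)
-- and the join is given by De Morgan, a ∨ b = (a⊥ ∧ b⊥)⊥.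
--
-- (⇒) If the category is Boolean, disjoint kernels are orthogonal, and from this
--     x⊥ ∨ y is the relative pseudocomplement x ⇨ y. An order-theoretic lattice with
--     x ⇨ y = ¬x ∨ y is a Boolean algebra in the order-theoretic sense, which we
--     convert, once and for all, into the algebraic notion of Boolean algebra.
-- (⇐) If KSub(X) is an algebraic Boolean algebra with order ≤, then m ∨ m⊥ = 1
--     (a morphism killing m and m⊥ vanishes), so for n with m ∧ n = 0 distributivity
--     gives n = (n ∧ m) ∨ (n ∧ m⊥) ≤ m⊥, i.e. m† ∘ n = 0.

open import Defs
open import Level using (_⊔_)
open import Function.Bundles using (_⇔_; mk⇔)
open import Data.Product using (Σ-syntax; _×_; _,_; proj₁; proj₂; swap)
open import Relation.Binary.PropositionalEquality using (_≡_; sym; trans; cong; cong₂; module ≡-Reasoning)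
open import Relation.Binary.Bundles using (Poset)
open import Relation.Binary.Structures using (IsPartialOrder)
open import Relation.Binary.Lattice using (IsBoundedLattice; BooleanAlgebra)
import Relation.Binary.Reasoning.PartialOrder
import Relation.Binary.Lattice.Properties.Lattice as LatticeProperties
import Relation.Binary.Lattice.Properties.MeetSemilattice as MeetProperties
import Relation.Binary.Lattice.Properties.JoinSemilattice as JoinProperties
import Relation.Binary.Lattice.Properties.HeytingAlgebra as HeytingProperties
import Relation.Binary.Lattice.Properties.DistributiveLattice as DistributiveProperties
import Algebra.Lattice.Structures as Alg
import Algebra.Lattice.Bundles as AlgBundles
import Algebra.Lattice.Properties.Lattice as AlgLatticeProperties

-- An order-theoretic Boolean algebra (a lattice in which ¬x ∨ y is the relative
-- pseudocomplement x ⇨ y) is an algebraic Boolean algebra whose order is x ≤ y ⇔ x ∧ y ≈ x.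
module OrderTheoreticBooleanAlgebra {c ℓ₁ ℓ₂} (B : BooleanAlgebra c ℓ₁ ℓ₂) where
  open BooleanAlgebra B renaming (trans to ≤-trans)
  open LatticeProperties lattice using (isAlgLattice)
  open MeetProperties meetSemilattice using (∧-monotonic; ∧-comm)
  open JoinProperties joinSemilattice using (∨-comm)
  open HeytingProperties heytingAlgebra using (distributiveLattice)
  open DistributiveProperties distributiveLattice using (∨-distrib-∧; ∧-distrib-∨)
  open import Relation.Binary.Reasoning.PartialOrder poset

  -- The complement laws are instances of the adjunction  w ∧ x ≤ y ⇔ w ≤ ¬x ∨ y.
  ¬x∧x≤⊥ : ∀ x → ¬ x ∧ x ≤ ⊥
  ¬x∧x≤⊥ x = transpose-∧ (x≤x∨y (¬ x) ⊥)

  ⊤≤¬x∨x : ∀ x → ⊤ ≤ ¬ x ∨ x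
  ⊤≤¬x∨x x = transpose-⇨ (x∧y≤y ⊤ x)

  ¬-antitone : ∀ {x y} → x ≤ y → ¬ y ≤ ¬ x
  ¬-antitone {x} {y} x≤y = begin
    ¬ y      ≤⟨ transpose-⇨ (≤-trans (∧-monotonic refl x≤y) (¬x∧x≤⊥ y)) ⟩
    ¬ x ∨ ⊥  ≤⟨ ∨-least refl (minimum (¬ x)) ⟩
    ¬ x      ∎

  -- Lattice laws and distributivity hold in every Heyting algebra.
  isAlgBooleanAlgebra : Alg.IsBooleanAlgebra _≈_ _∨_ _∧_ ¬_ ⊤ ⊥
  isAlgBooleanAlgebra = record
    { isDistributiveLattice = record
      { isLattice   = isAlgLattice
      ; ∨-distrib-∧ = ∨-distrib-∧
      ; ∧-distrib-∨ = ∧-distrib-∨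
      }
    ; ∨-complement = (λ x → antisym (maximum _) (⊤≤¬x∨x x))
                   , (λ x → Eq.trans (∨-comm x (¬ x)) (antisym (maximum _) (⊤≤¬x∨x x)))
    ; ∧-complement = (λ x → antisym (¬x∧x≤⊥ x) (minimum _))
                   , (λ x → Eq.trans (∧-comm x (¬ x)) (antisym (¬x∧x≤⊥ x) (minimum _)))
    ; ¬-cong = λ x≈y → antisym (¬-antitone (reflexive (Eq.sym x≈y))) (¬-antitone (reflexive x≈y))
    }

  ≤⇔∧≈ : ∀ x y → (x ≤ y → x ∧ y ≈ x) × (x ∧ y ≈ x → x ≤ y)
  ≤⇔∧≈ x y = (λ x≤y → antisym (x∧y≤x x y) (∧-greatest refl x≤y))
           , (λ x∧y≈x → ≤-trans (reflexive (Eq.sym x∧y≈x)) (x∧y≤y x y))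

module DaggerKernelFacts {o ℓ} (C : DaggerKernelCategory o ℓ) where
  open DaggerKernelCategory C
  open ≡-Reasoning

  zero-∘ : ∀ {A B D} (f : Hom A B) → zero {B} {D} ∘ f ≡ zero
  zero-∘ f = trans (assoc ¡ ! f) (cong (¡ ∘_) (!-unique (! ∘ f)))

  ∘-zero : ∀ {A B D} (f : Hom B D) → f ∘ zero {A} {B} ≡ zero
  ∘-zero f = trans (sym (assoc f ¡ !)) (cong (_∘ !) (¡-unique (f ∘ ¡)))

  zero-† : ∀ {A B} → (zero {A} {B}) † ≡ zero
  zero-† = trans (†-∘ ¡ !) (cong₂ _∘_ (¡-unique _) (!-unique _))

  †-annihilates : ∀ {A B D} {g : Hom B D} {f : Hom A B} → g ∘ f ≡ zero → (f †) ∘ (g †) ≡ zero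
  †-annihilates {g = g} {f} gf≡0 = begin
    (f †) ∘ (g †)  ≡⟨ sym (†-∘ g f) ⟩
    (g ∘ f) †      ≡⟨ cong _† gf≡0 ⟩
    zero †         ≡⟨ zero-† ⟩
    zero           ∎

  ⊥Obj : ∀ {A X} → Hom A X → Obj
  ⊥Obj f = KerObj (f †)

  _⊥ : ∀ {A X} (f : Hom A X) → Hom (⊥Obj f) X
  f ⊥ = ker (f †)

  †∘⊥ : ∀ {A X} (f : Hom A X) → (f †) ∘ (f ⊥) ≡ zero
  †∘⊥ f = IsKernel.equation (ker-isKernel (f †))

  ⊥†∘ : ∀ {A X} (f : Hom A X) → ((f ⊥) †) ∘ f ≡ zero
  ⊥†∘ f = trans (cong (((f ⊥) †) ∘_) (sym (†-inv f))) (†-annihilates (†∘⊥ f))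

  factor-⊥ : ∀ {A X W} (f : Hom A X) (g : Hom W X) → (f †) ∘ g ≡ zero →
             Σ[ φ ∈ Hom W (⊥Obj f) ] g ≡ (f ⊥) ∘ φ
  factor-⊥ f g f†g≡0 = IsKernel.factor K g f†g≡0 , sym (IsKernel.factor-eq K g f†g≡0)
    where K = ker-isKernel (f †)

  -- Dually, anything killing e factors through the cokernel (e⊥)† of e.
  cofactor-⊥ : ∀ {A X B} (h : Hom X B) (e : Hom A X) → h ∘ e ≡ zero →
               Σ[ ψ ∈ Hom B (⊥Obj e) ] h ≡ (ψ †) ∘ ((e ⊥) †)
  cofactor-⊥ h e he≡0 with factor-⊥ e (h †) (†-annihilates he≡0)
  ... | ψ , h†≡e⊥ψ = ψ , (begin
    h                 ≡⟨ sym (†-inv h) ⟩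
    (h †) †           ≡⟨ cong _† h†≡e⊥ψ ⟩
    ((e ⊥) ∘ ψ) †     ≡⟨ †-∘ (e ⊥) ψ ⟩
    (ψ †) ∘ ((e ⊥) †) ∎)

  kills-⊥⊥ : ∀ {A X B} (h : Hom X B) (e : Hom A X) → h ∘ e ≡ zero → h ∘ ((e ⊥) ⊥) ≡ zero
  kills-⊥⊥ h e he≡0 with cofactor-⊥ h e he≡0
  ... | ψ , h≡ψ†e⊥† = begin
    h ∘ ((e ⊥) ⊥)                      ≡⟨ cong (_∘ ((e ⊥) ⊥)) h≡ψ†e⊥† ⟩
    ((ψ †) ∘ ((e ⊥) †)) ∘ ((e ⊥) ⊥)    ≡⟨ assoc _ _ _ ⟩
    (ψ †) ∘ (((e ⊥) †) ∘ ((e ⊥) ⊥))    ≡⟨ cong ((ψ †) ∘_) (†∘⊥ (e ⊥)) ⟩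
    (ψ †) ∘ zero                       ≡⟨ ∘-zero _ ⟩
    zero                               ∎

  kernel-closed : ∀ {K X B W} (h : Hom X B) (m : Hom K X) → IsKernel category zeroObject h m →
                  (g : Hom W X) → ((m ⊥) †) ∘ g ≡ zero → Σ[ φ ∈ Hom W K ] g ≡ m ∘ φ
  kernel-closed h m isK g m⊥†g≡0 with cofactor-⊥ h m (IsKernel.equation isK)
  ... | ψ , h≡ψ†m⊥† = IsKernel.factor isK g hg≡0 , sym (IsKernel.factor-eq isK g hg≡0)
    where
      hg≡0 : h ∘ g ≡ zero
      hg≡0 = begin
        h ∘ g                        ≡⟨ cong (_∘ g) h≡ψ†m⊥† ⟩
        ((ψ †) ∘ ((m ⊥) †)) ∘ g      ≡⟨ assoc _ _ _ ⟩
        (ψ †) ∘ (((m ⊥) †) ∘ g)      ≡⟨ cong ((ψ †) ∘_) m⊥†g≡0 ⟩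
        (ψ †) ∘ zero                 ≡⟨ ∘-zero _ ⟩
        zero                         ∎

  dagger-mono-factor : ∀ {A B W} {m : Hom A B} → IsDaggerMono m →
                       (g : Hom W B) (φ : Hom W A) → g ≡ m ∘ φ → φ ≡ (m †) ∘ g
  dagger-mono-factor {m = m} m†m≡id g φ g≡mφ = begin
    φ                ≡⟨ sym (identityˡ φ) ⟩
    id ∘ φ           ≡⟨ cong (_∘ φ) (sym m†m≡id) ⟩
    ((m †) ∘ m) ∘ φ  ≡⟨ assoc _ _ _ ⟩
    (m †) ∘ (m ∘ φ)  ≡⟨ cong ((m †) ∘_) (sym g≡mφ) ⟩
    (m †) ∘ g        ∎

  self-orthogonal-zero : ∀ {A X} (f : Hom A X) → (f †) ∘ f ≡ zero → f ≡ zero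
  self-orthogonal-zero f f†f≡0 with factor-⊥ f f f†f≡0
  ... | φ , f≡f⊥φ = begin
    f            ≡⟨ f≡f⊥φ ⟩
    (f ⊥) ∘ φ    ≡⟨ cong ((f ⊥) ∘_) φ≡0 ⟩
    (f ⊥) ∘ zero ≡⟨ ∘-zero _ ⟩
    zero         ∎
    where
      φ≡0 : φ ≡ zero
      φ≡0 = trans (dagger-mono-factor (ker-daggerMono (f †)) f φ f≡f⊥φ) (⊥†∘ f)

  jointly-zero : ∀ {A X B} (m : Hom A X) (h : Hom X B) →
                 h ∘ m ≡ zero → h ∘ (m ⊥) ≡ zero → h ≡ zero
  jointly-zero m h hm≡0 hm⊥≡0 with factor-⊥ m (h †) (†-annihilates hm≡0)
  ... | ψ , h†≡m⊥ψ = begin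
    h          ≡⟨ sym (†-inv h) ⟩
    (h †) †    ≡⟨ cong _† (self-orthogonal-zero (h †) h††h†≡0) ⟩
    zero †     ≡⟨ zero-† ⟩
    zero       ∎
    where
      h††h†≡0 : ((h †) †) ∘ (h †) ≡ zero
      h††h†≡0 = begin
        ((h †) †) ∘ (h †)   ≡⟨ cong₂ _∘_ (†-inv h) h†≡m⊥ψ ⟩
        h ∘ ((m ⊥) ∘ ψ)     ≡⟨ sym (assoc _ _ _) ⟩
        (h ∘ (m ⊥)) ∘ ψ     ≡⟨ cong (_∘ ψ) hm⊥≡0 ⟩
        zero ∘ ψ            ≡⟨ zero-∘ ψ ⟩
        zero                ∎

module KSubLattice {o ℓ} (C : DaggerKernelCategory o ℓ) (X : DaggerKernelCategory.Obj C) where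
  open DaggerKernelCategory C
  open KSubDefs C
  open DaggerKernelFacts C

  ≤K-refl : ∀ {m : KSubElt X} → m ≤K m
  ≤K-refl {m} = id , sym (identityʳ (arr m))

  ≤K-trans : ∀ {k m n : KSubElt X} → k ≤K m → m ≤K n → k ≤K n
  ≤K-trans {k} {m} {n} (φ , k≡mφ) (ψ , m≡nψ) = ψ ∘ φ , (begin
    arr k            ≡⟨ k≡mφ ⟩
    arr m ∘ φ        ≡⟨ cong (_∘ φ) m≡nψ ⟩
    (arr n ∘ ψ) ∘ φ  ≡⟨ assoc _ _ _ ⟩
    arr n ∘ (ψ ∘ φ)  ∎)
    where open ≡-Reasoning

  ≤K-isPartialOrder : IsPartialOrder (_≈K_ {X}) _≤K_
  ≤K-isPartialOrder = record
    { isPreorder = record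
      { isEquivalence = record
        { refl  = λ {m} → ≤K-refl {m} , ≤K-refl {m}
        ; sym   = swap
        ; trans = λ {k} {m} {n} (k≤m , m≤k) (m≤n , n≤m) →
                    ≤K-trans {k} {m} {n} k≤m m≤n , ≤K-trans {n} {m} {k} n≤m m≤k
        }
      ; reflexive = proj₁
      ; trans     = λ {k} {m} {n} → ≤K-trans {k} {m} {n}
      }
    ; antisym = _,_
    }

  KSubPoset : Poset (o ⊔ ℓ) ℓ ℓ
  KSubPoset = record { isPartialOrder = ≤K-isPartialOrder }

  module ≤-Reasoning = Relation.Binary.Reasoning.PartialOrder KSubPoset

  orth : ∀ {A} → Hom A X → KSubElt X
  orth {A} f = ksub (⊥Obj f) (f ⊥) (A , f † , ker-isKernel (f †))

  ≤-orth : ∀ {A} (f : Hom A X) (k : KSubElt X) → (f †) ∘ arr k ≡ zero → k ≤K orth f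
  ≤-orth f k = factor-⊥ f (arr k)

  ≤-orth⁻¹ : ∀ {A} (f : Hom A X) (k : KSubElt X) → k ≤K orth f → (f †) ∘ arr k ≡ zero
  ≤-orth⁻¹ f k (φ , k≡f⊥φ) = begin
    (f †) ∘ arr k            ≡⟨ cong ((f †) ∘_) k≡f⊥φ ⟩
    (f †) ∘ ((f ⊥) ∘ φ)      ≡⟨ sym (assoc _ _ _) ⟩
    ((f †) ∘ (f ⊥)) ∘ φ      ≡⟨ cong (_∘ φ) (†∘⊥ f) ⟩
    zero ∘ φ                 ≡⟨ zero-∘ φ ⟩
    zero                     ∎
    where open ≡-Reasoning

  -- k lies below n exactly when (n⊥)† kills k; the backward direction is the
  -- closedness of the kernel n.
  ≤-by-⊥† : (k n : KSubElt X) → ((arr n ⊥) †) ∘ arr k ≡ zero → k ≤K n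
  ≤-by-⊥† k (ksub _ n (_ , h , n-isKernel)) = kernel-closed h n n-isKernel (arr k)

  ≤-by-⊥†⁻¹ : (k n : KSubElt X) → k ≤K n → ((arr n ⊥) †) ∘ arr k ≡ zero
  ≤-by-⊥†⁻¹ k n (φ , k≡nφ) = begin
    ((arr n ⊥) †) ∘ arr k          ≡⟨ cong (((arr n ⊥) †) ∘_) k≡nφ ⟩
    ((arr n ⊥) †) ∘ (arr n ∘ φ)    ≡⟨ sym (assoc _ _ _) ⟩
    (((arr n ⊥) †) ∘ arr n) ∘ φ    ≡⟨ cong (_∘ φ) (⊥†∘ (arr n)) ⟩
    zero ∘ φ                       ≡⟨ zero-∘ φ ⟩
    zero                           ∎
    where open ≡-Reasoning

  compl : KSubElt X → KSubElt X
  compl m = orth (arr m)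

  compl-antitone : ∀ {m n : KSubElt X} → m ≤K n → compl n ≤K compl m
  compl-antitone {m} {n} (φ , m≡nφ) = ≤-orth (arr m) (compl n) (begin
    (arr m †) ∘ (arr n ⊥)            ≡⟨ cong (λ g → (g †) ∘ (arr n ⊥)) m≡nφ ⟩
    ((arr n ∘ φ) †) ∘ (arr n ⊥)      ≡⟨ cong (_∘ (arr n ⊥)) (†-∘ (arr n) φ) ⟩
    ((φ †) ∘ (arr n †)) ∘ (arr n ⊥)  ≡⟨ assoc _ _ _ ⟩
    (φ †) ∘ ((arr n †) ∘ (arr n ⊥))  ≡⟨ cong ((φ †) ∘_) (†∘⊥ (arr n)) ⟩
    (φ †) ∘ zero                     ≡⟨ ∘-zero (φ †) ⟩
    zero                             ∎)
    where open ≡-Reasoning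

  ≤-compl-compl : ∀ (m : KSubElt X) → m ≤K compl (compl m)
  ≤-compl-compl m = ≤-orth (arr m ⊥) m (⊥†∘ (arr m))

  compl-compl-≤ : ∀ (m : KSubElt X) → compl (compl m) ≤K m
  compl-compl-≤ m = ≤-by-⊥† (compl (compl m)) m (†∘⊥ (arr m ⊥))

  disjoint : ∀ {k m : KSubElt X} → k ≤K m → k ≤K compl m → k ≤K ⊥K
  disjoint {k} {m} (φ , k≡mφ) k≤m⊥ = ! , self-orthogonal-zero (arr k) k†k≡0
    where
      open ≡-Reasoning
      k†k≡0 : (arr k †) ∘ arr k ≡ zero
      k†k≡0 = begin
        (arr k †) ∘ arr k              ≡⟨ cong (λ g → (g †) ∘ arr k) k≡mφ ⟩
        ((arr m ∘ φ) †) ∘ arr k        ≡⟨ cong (_∘ arr k) (†-∘ (arr m) φ) ⟩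
        ((φ †) ∘ (arr m †)) ∘ arr k    ≡⟨ assoc _ _ _ ⟩
        (φ †) ∘ ((arr m †) ∘ arr k)    ≡⟨ cong ((φ †) ∘_) (≤-orth⁻¹ (arr m) k k≤m⊥) ⟩
        (φ †) ∘ zero                   ≡⟨ ∘-zero (φ †) ⟩
        zero                           ∎

  closure : ∀ {A} → Hom A X → KSubElt X
  closure f = orth (f ⊥)

  factors-through-closure : ∀ {A} (f : Hom A X) → Σ[ ω ∈ Hom A (dom (closure f)) ] f ≡ arr (closure f) ∘ ω
  factors-through-closure f = factor-⊥ (f ⊥) f (⊥†∘ f)

  closure-least : ∀ {A} (f : Hom A X) (n : KSubElt X) → ((arr n ⊥) †) ∘ f ≡ zero → closure f ≤K n
  closure-least f n n⊥†f≡0 = ≤-by-⊥† (closure f) n (kills-⊥⊥ ((arr n ⊥) †) f n⊥†f≡0)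

  -- The meet a ∧ b: the closure of the pullback of b along a, a ∘ ker((b⊥)† ∘ a).
  module Pullback (a b : KSubElt X) where
    restrict : Hom (KerObj (((arr b ⊥) †) ∘ arr a)) (dom a)
    restrict = ker (((arr b ⊥) †) ∘ arr a)

    restrict-isKernel : IsKernel category zeroObject (((arr b ⊥) †) ∘ arr a) restrict
    restrict-isKernel = ker-isKernel (((arr b ⊥) †) ∘ arr a)

    pullback : Hom (KerObj (((arr b ⊥) †) ∘ arr a)) X
    pullback = arr a ∘ restrict

  meet : KSubElt X → KSubElt X → KSubElt X
  meet a b = closure (Pullback.pullback a b)

  meet-≤ˡ : ∀ (a b : KSubElt X) → meet a b ≤K a
  meet-≤ˡ a b = closure-least pullback a (begin
    ((arr a ⊥) †) ∘ (arr a ∘ restrict)  ≡⟨ sym (assoc _ _ _) ⟩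
    (((arr a ⊥) †) ∘ arr a) ∘ restrict  ≡⟨ cong (_∘ restrict) (⊥†∘ (arr a)) ⟩
    zero ∘ restrict                     ≡⟨ zero-∘ restrict ⟩
    zero                                ∎)
    where open ≡-Reasoning
          open Pullback a b

  meet-≤ʳ : ∀ (a b : KSubElt X) → meet a b ≤K b
  meet-≤ʳ a b = closure-least pullback b
    (trans (sym (assoc _ _ _)) (IsKernel.equation restrict-isKernel))
    where open Pullback a b

  meet-greatest : ∀ {a b k : KSubElt X} → k ≤K a → k ≤K b → k ≤K meet a b
  meet-greatest {a} {b} {k} (ψ , k≡aψ) k≤b = ω ∘ χ , (begin
    arr k                          ≡⟨ k≡aψ ⟩
    arr a ∘ ψ                      ≡⟨ cong (arr a ∘_) (sym (IsKernel.factor-eq restrict-isKernel ψ b⊥†aψ≡0)) ⟩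
    arr a ∘ (restrict ∘ χ)         ≡⟨ sym (assoc _ _ _) ⟩
    pullback ∘ χ                   ≡⟨ cong (_∘ χ) pullback≡ ⟩
    (arr (meet a b) ∘ ω) ∘ χ       ≡⟨ assoc _ _ _ ⟩
    arr (meet a b) ∘ (ω ∘ χ)       ∎)
    where
      open ≡-Reasoning
      open Pullback a b
      b⊥†aψ≡0 : (((arr b ⊥) †) ∘ arr a) ∘ ψ ≡ zero
      b⊥†aψ≡0 = trans (assoc _ _ _)
                  (trans (cong (((arr b ⊥) †) ∘_) (sym k≡aψ)) (≤-by-⊥†⁻¹ k b k≤b))
      χ = IsKernel.factor restrict-isKernel ψ b⊥†aψ≡0
      ω = proj₁ (factors-through-closure pullback)
      pullback≡ = proj₂ (factors-through-closure pullback)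

  join : KSubElt X → KSubElt X → KSubElt X
  join a b = compl (meet (compl a) (compl b))

  join-≥ˡ : ∀ (a b : KSubElt X) → a ≤K join a b
  join-≥ˡ a b = begin
    a                                ≤⟨ ≤-compl-compl a ⟩
    compl (compl a)                  ≤⟨ compl-antitone {meet (compl a) (compl b)} {compl a} (meet-≤ˡ (compl a) (compl b)) ⟩
    join a b                         ∎
    where open ≤-Reasoning

  join-≥ʳ : ∀ (a b : KSubElt X) → b ≤K join a b
  join-≥ʳ a b = begin
    b                                ≤⟨ ≤-compl-compl b ⟩
    compl (compl b)                  ≤⟨ compl-antitone {meet (compl a) (compl b)} {compl b} (meet-≤ʳ (compl a) (compl b)) ⟩
    join a b                         ∎
    where open ≤-Reasoning

  join-least : ∀ {a b c : KSubElt X} → a ≤K c → b ≤K c → join a b ≤K c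
  join-least {a} {b} {c} a≤c b≤c = begin
    join a b          ≤⟨ compl-antitone {compl c} {meet (compl a) (compl b)}
                           (meet-greatest {compl a} {compl b} {compl c}
                             (compl-antitone {a} {c} a≤c) (compl-antitone {b} {c} b≤c)) ⟩
    compl (compl c)   ≤⟨ compl-compl-≤ c ⟩
    c                 ∎
    where open ≤-Reasoning

  ⊤K : KSubElt X
  ⊤K = compl ⊥K

  ≤-⊤K : ∀ (a : KSubElt X) → a ≤K ⊤K
  ≤-⊤K a = ≤-orth ¡ a (trans (!-unique _) (sym (!-unique zero)))

  ⊥K-≤ : ∀ (a : KSubElt X) → ⊥K ≤K a
  ⊥K-≤ a = ¡ , sym (¡-unique (arr a ∘ ¡))

  ksub-isBoundedLattice : IsBoundedLattice (_≈K_ {X}) _≤K_ join meet ⊤K ⊥K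
  ksub-isBoundedLattice = record
    { isLattice = record
      { isPartialOrder = ≤K-isPartialOrder
      ; supremum = λ a b → join-≥ˡ a b , join-≥ʳ a b , λ c → join-least {a} {b} {c}
      ; infimum  = λ a b → meet-≤ˡ a b , meet-≤ʳ a b , λ k → meet-greatest {a} {b} {k}
      }
    ; maximum = ≤-⊤K
    ; minimum = ⊥K-≤
    }

  -- An element above both m and m⊥ is the top: (k⊥)† kills m and m⊥, hence vanishes.
  ≥-compl-pair : ∀ {m k : KSubElt X} → m ≤K k → compl m ≤K k → ∀ n → n ≤K k
  ≥-compl-pair {m} {k} m≤k m⊥≤k n = ≤-by-⊥† n k (begin
    ((arr k ⊥) †) ∘ arr n   ≡⟨ cong (_∘ arr n) k⊥†≡0 ⟩
    zero ∘ arr n            ≡⟨ zero-∘ (arr n) ⟩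
    zero                    ∎)
    where
      open ≡-Reasoning
      k⊥†≡0 : (arr k ⊥) † ≡ zero
      k⊥†≡0 = jointly-zero (arr m) ((arr k ⊥) †)
                (≤-by-⊥†⁻¹ m k m≤k) (≤-by-⊥†⁻¹ (compl m) k m⊥≤k)

  module Boolean (isBoolean : IsBooleanDKC C) where
    disjoint⇒≤compl : ∀ {u v : KSubElt X} → meet u v ≤K ⊥K → u ≤K compl v
    disjoint⇒≤compl {u} {v} u∧v≤⊥ = ≤-orth (arr v) u (isBoolean v u meet-is-zero)
      where
        meet-is-zero : MeetIsZero v u
        meet-is-zero k k≤v k≤u = ≤K-trans {k} {meet u v} {⊥K} (meet-greatest {u} {v} {k} k≤u k≤v) u∧v≤⊥

    -- The two halves of  w ∧ x ≤ y ⇔ w ≤ x⊥ ∨ y,  each reduced to a disjointness via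
    -- disjoint⇒≤compl and the fact that nothing nonzero lies below both q and q⊥.
    meet-⇨ : ∀ (w x y : KSubElt X) → meet w x ≤K y → w ≤K join (compl x) y
    meet-⇨ w x y w∧x≤y = disjoint⇒≤compl {w} {q} (disjoint {meet w q} {y} k≤y (begin
      meet w q          ≤⟨ meet-≤ʳ w q ⟩
      q                 ≤⟨ meet-≤ʳ (compl (compl x)) (compl y) ⟩
      compl y           ∎))
      where
        open ≤-Reasoning
        q = meet (compl (compl x)) (compl y)
        k≤y : meet w q ≤K y
        k≤y = begin
          meet w q          ≤⟨ meet-greatest {w} {x} {meet w q} (meet-≤ˡ w q) (begin
            meet w q          ≤⟨ meet-≤ʳ w q ⟩
            q                 ≤⟨ meet-≤ˡ (compl (compl x)) (compl y) ⟩
            compl (compl x)   ≤⟨ compl-compl-≤ x ⟩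
            x                 ∎) ⟩
          meet w x          ≤⟨ w∧x≤y ⟩
          y                 ∎

    ⇨-meet : ∀ (w x y : KSubElt X) → w ≤K join (compl x) y → meet w x ≤K y
    ⇨-meet w x y w≤x⇨y = begin
      meet w x          ≤⟨ disjoint⇒≤compl {meet w x} {compl y} (disjoint {k} {q} k≤q (begin
        k                 ≤⟨ meet-≤ˡ (meet w x) (compl y) ⟩
        meet w x          ≤⟨ meet-≤ˡ w x ⟩
        w                 ≤⟨ w≤x⇨y ⟩
        compl q           ∎)) ⟩
      compl (compl y)   ≤⟨ compl-compl-≤ y ⟩
      y                 ∎
      where
        open ≤-Reasoning
        q = meet (compl (compl x)) (compl y)
        k = meet (meet w x) (compl y)
        k≤q : k ≤K q
        k≤q = meet-greatest {compl (compl x)} {compl y} {k} (begin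
          k                 ≤⟨ meet-≤ˡ (meet w x) (compl y) ⟩
          meet w x          ≤⟨ meet-≤ʳ w x ⟩
          x                 ≤⟨ ≤-compl-compl x ⟩
          compl (compl x)   ∎) (meet-≤ʳ (meet w x) (compl y))

    ksub-booleanAlgebra : BooleanAlgebra (o ⊔ ℓ) ℓ ℓ
    ksub-booleanAlgebra = record
      { Carrier = KSubElt X
      ; _≈_ = _≈K_
      ; _≤_ = _≤K_
      ; _∨_ = join
      ; _∧_ = meet
      ; ¬_  = compl
      ; ⊤   = ⊤K
      ; ⊥   = ⊥K
      ; isBooleanAlgebra = record
        { isHeytingAlgebra = record
          { isBoundedLattice = ksub-isBoundedLattice
          ; exponential = λ w x y → meet-⇨ w x y , ⇨-meet w x y
          }
        }
      }

  -- Conversely, suppose KSub(X) carries an (algebraic) Boolean algebra structure whose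
  -- induced order is ≤K. Then disjoint kernels are orthogonal: n ≤ n ∧ (m ∨ m⊥)
  -- = (n ∧ m) ∨ (n ∧ m⊥) ≤ m⊥, since m ∨ m⊥ is the top and n ∧ m is 0.
  module FromBooleanAlgebra
    {_∨_ _∧_ : KSubElt X → KSubElt X → KSubElt X} {¬_ : KSubElt X → KSubElt X} {top bot : KSubElt X}
    (isBooleanAlgebra : Alg.IsBooleanAlgebra (_≈K_ {X}) _∨_ _∧_ ¬_ top bot)
    (order : ∀ m n → ((m ≤K n → (m ∧ n) ≈K m) × ((m ∧ n) ≈K m → m ≤K n))) where
    open Alg.IsBooleanAlgebra isBooleanAlgebra using (isLattice; ∧-distribˡ-∨)

    lattice : AlgBundles.Lattice (o ⊔ ℓ) ℓ
    lattice = record { isLattice = isLattice }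

    open AlgLatticeProperties lattice using (∨-∧-orderTheoreticLattice)
    open Relation.Binary.Lattice.Lattice ∨-∧-orderTheoreticLattice
      using (x∧y≤x; x∧y≤y; ∧-greatest; x≤x∨y; y≤x∨y; ∨-least)
      renaming (_≤_ to _≤ᴸ_; refl to ≤ᴸ-refl)

    from-≤ᴸ : ∀ {x y} → x ≤ᴸ y → x ≤K y
    from-≤ᴸ {x} {y} x≈x∧y = proj₂ (order x y) (swap x≈x∧y)

    to-≤ᴸ : ∀ {x y} → x ≤K y → x ≤ᴸ y
    to-≤ᴸ {x} {y} x≤y = swap (proj₁ (order x y) x≤y)

    disjoint⇒orthogonal : ∀ (m n : KSubElt X) → MeetIsZero m n → (arr m †) ∘ arr n ≡ zero
    disjoint⇒orthogonal m n m∧n≤⊥ = ≤-orth⁻¹ (arr m) n (begin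
      n                                ≤⟨ from-≤ᴸ (∧-greatest (≤ᴸ-refl {n}) (to-≤ᴸ n≤m∨m⊥)) ⟩
      n ∧ (m ∨ compl m)                ≤⟨ proj₁ (∧-distribˡ-∨ n m (compl m)) ⟩
      (n ∧ m) ∨ (n ∧ compl m)          ≤⟨ from-≤ᴸ (∨-least (to-≤ᴸ n∧m≤m⊥) (x∧y≤y n (compl m))) ⟩
      compl m                          ∎)
      where
        open ≤-Reasoning
        n≤m∨m⊥ : n ≤K (m ∨ compl m)
        n≤m∨m⊥ = ≥-compl-pair {m} {m ∨ compl m} (from-≤ᴸ (x≤x∨y m (compl m))) (from-≤ᴸ (y≤x∨y m (compl m))) n
        n∧m≤m⊥ : (n ∧ m) ≤K compl m
        n∧m≤m⊥ = ≤K-trans {n ∧ m} {⊥K} {compl m}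
                   (m∧n≤⊥ (n ∧ m) (from-≤ᴸ (x∧y≤y n m)) (from-≤ᴸ (x∧y≤x n m))) (⊥K-≤ (compl m))

theorem6p3 : ∀ {o ℓ} (C : DaggerKernelCategory o ℓ) →
    IsBooleanDKC C ⇔ (∀ X → KSubDefs.KSubIsBooleanAlgebra C X)
theorem6p3 C = mk⇔ boolean⇒ksub-boolean ksub-boolean⇒boolean
  where
    open KSubDefs C using (⊥K; KSubIsBooleanAlgebra)

    boolean⇒ksub-boolean : IsBooleanDKC C → ∀ X → KSubIsBooleanAlgebra X
    boolean⇒ksub-boolean isBoolean X =
      join , meet , compl , ⊤K , ⊥K , isAlgBooleanAlgebra , ≤⇔∧≈
      where
        open KSubLattice C X
        open OrderTheoreticBooleanAlgebra (Boolean.ksub-booleanAlgebra isBoolean)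

    ksub-boolean⇒boolean : (∀ X → KSubIsBooleanAlgebra X) → IsBooleanDKC C
    ksub-boolean⇒boolean ksub-boolean {X} =
      let (_ , _ , _ , _ , _ , isBooleanAlgebra , order) = ksub-boolean X
      in KSubLattice.FromBooleanAlgebra.disjoint⇒orthogonal C X isBooleanAlgebra order
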